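{- Let $\mathcal{Q}_0=\{(3,4)\}$ and, for $k\ge 0$, let $\mathcal{Q}_{k+1}$ be obtained from $\mathcal{Q}_k$ by replacing each pair $(d,W)\in\mathcal{Q}_k$ by the two pairs $\left(\tfrac{2d_0}{3},\,2W\right)$ and $\left(\tfrac{4d_1-1}{3},\,4W\right)$, where $d_0$ is the least element of $\{d+Wj: j\in\mathbb{N}_0\}$ divisible by $3$ and $d_1$ is the least element of $\{d+Wj: j\in\mathbb{N}_0\}$ congruent to $1\pmod 3$. Then for every $k\ge 0$ and every $(d,W)\in\mathcal{Q}_k$ one has $d<W$.
   Context: $\mathbb{N}=\{1,2,3,\dots\}$ and $\mathbb{N}_0=\{0\}\cup\mathbb{N}$. The map $F_l^{ -1}:\{3+3m: m\in\mathbb{N}_0\}\cup\{1+3m: m\in\mathbb{N}_0\}\to\mathbb{N}$ is defined by $F_l^{ -1}(3+3m)=2+2m$ and $F_l^{ -1}(1+3m)=1+4m$, i.e. $x\mapsto 2x/3$ for $x\equiv 0\pmod 3$ and $x\mapsto (4x-1)/3$ for $x\equiv 1 \pmod 3$. Set $B_0=\{3+4m: m\in\mathbb{N}_0\}$ and $B_{k+1}=F_l^{ -1}(B_k)$. Every interval $W$ occurring in $\mathcal{Q}_k$ is a power of $2$, so $d_0,d_1$ exist; the arithmetic progressions $\{d+Wj: j\in\mathbb{N}_0\}$, $(d,W)\in\mathcal{Q}_k$, are the "$y$-proportional subsets" of $B_k$, with intercept $d$ and interval $W$ (each new pair is the intercept and interval of the image under $F_l^{ -1}$ of the elements $\equiv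 0$, respectively $\equiv 1 \pmod 3$, of a progression of the previous stage). -}

module Defs where

open import Data.Nat using (ℕ; zero; suc; _+_; _*_; _∸_; _≤_; _<_)
open import Data.Nat.DivMod using (_/_; _%_)
open import Data.Nat.Divisibility using (_∣_)
open import Data.Product using (Σ; _×_)
open import Relation.Binary.PropositionalEquality using (_≡_)

LeastIn : ℕ → ℕ → (ℕ → Set) → ℕ → Set
LeastIn d W P m =
  (Σ ℕ λ j → m ≡ d + W * j) × P m × (∀ j → P (d + W * j) → m ≤ d + W * j)

data InQ : ℕ → ℕ → ℕ → Set where
  base  : InQ 0 3 4
  step0 : ∀ {k d W d₀} → InQ k d W → LeastIn d W (λ x → 3 ∣ x) d₀ →
          InQ (suc k) ((2 * d₀) / 3) (2 * W)
  step1 : ∀ {k d W d₁} → InQ k d W → LeastIn d W (λ x → x % 3 ≡ 1) d₁ →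
          InQ (suc k) ((4 * d₁ ∸ 1) / 3) (4 * W)

{-# OPTIONS --safe #-}
module Submission where

-- The tests defining d₀ and d₁ only see the residue mod 3, which does not change
-- when 3W is added, so minimality forces the least passing term d + W j to have
-- j < 3. If d < W this term is below 3W, hence 2d₀/3 < 2W and (4d₁ - 1)/3 < 4W.

open import Defs
open import Data.Nat using (ℕ; suc; z≤n; s≤s; _+_; _*_; _∸_; _≤_; _<_; NonZero; >-nonZero; >-nonZero⁻¹)
open import Data.Nat.Properties
open import Data.Nat.DivMod using (_/_; _%_; [m+kn]%n≡m%n; m<n*o⇒m/o<n)
open import Data.Nat.Divisibility using (_∣_; ∣m+n∣m⇒∣n; n∣m*n)
open import Data.Product using (_,_)
open import Relation.Nullary using (yes; no; contradiction)
open import Relation.Binary.PropositionalEquality using (_≡_; sym; trans; cong; subst)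

LeastIn-periodic⇒< : ∀ (P : ℕ → Set) {d W m} n .{{_ : NonZero n}} → d < W →
                     (∀ x → P (x + W * n) → P x) → LeastIn d W P m → m < W * n
LeastIn-periodic⇒< P {d} {W} {m} n d<W descend ((j , m≡) , Pm , least) = begin-strict
  m            ≡⟨ m≡ ⟩
  d + W * j    <⟨ +-monoˡ-< (W * j) d<W ⟩
  W + W * j    ≡⟨ sym (*-suc W j) ⟩
  W * suc j    ≤⟨ *-monoʳ-≤ W j<n ⟩
  W * n        ∎
  where
  open ≤-Reasoning

  W*n>0 : 0 < W * n
  W*n>0 = >-nonZero⁻¹ (W * n) {{m*n≢0 W n {{>-nonZero (≤-<-trans z≤n d<W)}}}}

  j<n : j < n
  j<n with n ≤? j
  ... | no n≰j = ≰⇒> n≰j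
  ... | yes n≤j = contradiction m≤x (<⇒≱ x<m)
    where
    i = j ∸ n
    x = d + W * i
    m≡x+Wn : m ≡ x + W * n
    m≡x+Wn = begin-equality
      m                    ≡⟨ m≡ ⟩
      d + W * j            ≡⟨ cong (λ t → d + W * t) (sym (m∸n+n≡m n≤j)) ⟩
      d + W * (i + n)      ≡⟨ cong (d +_) (*-distribˡ-+ W i n) ⟩
      d + (W * i + W * n)  ≡⟨ sym (+-assoc d (W * i) (W * n)) ⟩
      x + W * n            ∎

    m≤x : m ≤ x
    m≤x = least i (descend x (subst P m≡x+Wn Pm))
    x<m : x < m
    x<m = subst (x <_) (sym m≡x+Wn) (m<m+n x W*n>0)

∣-descends : ∀ {n} W x → n ∣ x + W * n → n ∣ x
∣-descends {n} W x n∣x+Wn = ∣m+n∣m⇒∣n (subst (n ∣_) (+-comm x (W * n)) n∣x+Wn) (n∣m*n W)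

%-descends : ∀ {n r} .{{_ : NonZero n}} W x → (x + W * n) % n ≡ r → x % n ≡ r
%-descends {n} W x eq = trans (sym ([m+kn]%n≡m%n x W n)) eq

scaled-quotient< : ∀ c W e {n m} .{{_ : NonZero c}} .{{_ : NonZero n}} →
                   m < W * n → (c * m ∸ e) / n < c * W
scaled-quotient< c W e {n} {m} m<Wn = m<n*o⇒m/o<n (begin-strict
  c * m ∸ e    ≤⟨ m∸n≤m (c * m) e ⟩
  c * m        <⟨ *-monoʳ-< c m<Wn ⟩
  c * (W * n)  ≡⟨ sym (*-assoc c W n) ⟩
  c * W * n    ∎)
  where open ≤-Reasoning

lemma4 : ∀ (k d W : ℕ) → InQ k d W → d < W
lemma4 .0 .3 .4 base = s≤s (s≤s (s≤s (s≤s z≤n)))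
-- 2 * d₀ ∸ 0 reduces to 2 * d₀, matching the intercept of step0.
lemma4 _ _ _ (step0 {k} {d} {W} q least) =
  scaled-quotient< 2 W 0 (LeastIn-periodic⇒< (3 ∣_) 3 (lemma4 k d W q) (∣-descends W) least)
lemma4 _ _ _ (step1 {k} {d} {W} q least) =
  scaled-quotient< 4 W 1 (LeastIn-periodic⇒< (λ x → x % 3 ≡ 1) 3 (lemma4 k d W q) (%-descends W) least)
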